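{- Assume the setting below, and that $Q(X)\neq\emptyset$ for every object $X$ of $\mathsf{C}$. If $(0,\omega)$ is a dualizing object of $\int Q$, then for every object $X$ of $\mathsf{C}$ the monotone map $\omega_X:Q(X)^{op}\to Q(X^{*})$ is an isomorphism of posets.
   Context: $(\mathsf{C},\otimes,I,a,\lambda,\rho,\sigma)$ is symmetric monoidal closed with internal hom $\multimap$, unit $\eta_{X,Y}$, counit $\mathrm{ev}_{X,Y}:X\otimes(X\multimap Y)\to Y$. $Q:\mathsf{C}\to\mathsf{Pos}$ is a functor with $u\in Q(I)$ and monotone lax natural maps $\mu_{X,Y}:Q(X)\times Q(Y)\to Q(X\otimes Y)$ satisfying the coherence equalities $Q(\lambda_Y)(\mu_{I,Y}(u,y))=y$, $Q(\rho_X)(\mu_{X,I}(x,u))=x$, $Q(a)(\mu(\mu(x,y),z))=\mu(x,\mu(y,z))$, $Q(\sigma_{X,Y})(\mu_{X,Y}(x,y))=\mu_{Y,X}(y,x)$. $\int Q$ has objects $(X,x)$, $x\in Q(X)$, and arrows $f:(X,x)\to(Y,y)$ with $Q(f)(x)\le y$. Put $\langle x,b\rangle_{X,Y}:=Q(\mathrm{ev}_{X,Y})(\mu_{X,X\multimap Y}(x,b))$. Assume $\mu_{X,Y}(x,y)=\langle x,Q(\eta_{X,Y})(y)\rangle_{X,X\otimes Y}$ and that each $\langle\alpha,-\rangle_{X,Y}$ has a right adjoint $\iota_{X,Y}(\alpha,-)$, so that $\int Q$ is symmetric monoidal closed with $(X,\alpha)\multimap(Y,\beta)=(X\multimap Y,\iota_{X,Y}(\alpha,\beta))$.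 Fix $0$ in $\mathsf{C}$ and $\omega\in Q(0)$; $X^*:=X\multimap0$, $\omega_X(\alpha):=\iota_{X,0}(\alpha,\omega)$ (antitone in $\alpha$). $j_X:X\to X^{**}$ is the canonical arrow (transpose of $\mathrm{ev}_{X,0}\circ\sigma_{X^*,X}$). $(0,\omega)$ is dualizing in $\int Q$ if each canonical arrow $j_X:(X,\alpha)\to(X^{**},\omega_{X^*}(\omega_X(\alpha)))$ of $\int Q$ is invertible in $\int Q$. -}

module Defs where

open import Level using (Level; _⊔_) renaming (suc to lsuc)
open import Function using (flip)
open import Data.Product using (Σ; _×_; _,_)
open import Function.Bundles using (_⇔_)
open import Relation.Binary.Bundles using (Poset)
open import Relation.Binary.PropositionalEquality using (_≡_)
open import Relation.Binary.Morphism.Structures using (IsOrderIsomorphism)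

-- Notation follows the paper:
--   a  : (X ⊗ Y) ⊗ Z → X ⊗ (Y ⊗ Z)
--   lu : I ⊗ Y → Y          (the paper's λ)
--   ru : X ⊗ I → X          (the paper's ρ)
--   σ  : X ⊗ Y → Y ⊗ X
--   X ⊸ - is right adjoint to X ⊗ -, with unit
--   η : Y → X ⊸ (X ⊗ Y) and counit ev : X ⊗ (X ⊸ Y) → Y.

record SMCC (o h : Level) : Set (lsuc (o ⊔ h)) where
  infixr 9 _∘_
  infixr 10 _⊗₀_ _⊗₁_
  infixr 8 _⊸₀_
  field
    Obj : Set o
    Hom : Obj → Obj → Set h
    id  : ∀ {A} → Hom A A
    _∘_ : ∀ {A B C} → Hom B C → Hom A B → Hom A C
    identityˡ : ∀ {A B} {f : Hom A B} → id ∘ f ≡ f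
    identityʳ : ∀ {A B} {f : Hom A B} → f ∘ id ≡ f
    assoc     : ∀ {A B C D} {f : Hom A B} {g : Hom B C} {k : Hom C D} →
                (k ∘ g) ∘ f ≡ k ∘ (g ∘ f)

    _⊗₀_ : Obj → Obj → Obj
    _⊗₁_ : ∀ {A B C D} → Hom A B → Hom C D → Hom (A ⊗₀ C) (B ⊗₀ D)
    ⊗-id : ∀ {A C} → id {A} ⊗₁ id {C} ≡ id
    ⊗-∘  : ∀ {A B B' C D D'} {f : Hom A B} {f' : Hom B B'} {g : Hom C D} {g' : Hom D D'} →
           (f' ∘ f) ⊗₁ (g' ∘ g) ≡ (f' ⊗₁ g') ∘ (f ⊗₁ g)
    I : Obj

    a   : ∀ {X Y Z} → Hom ((X ⊗₀ Y) ⊗₀ Z) (X ⊗₀ (Y ⊗₀ Z))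
    a⁻¹ : ∀ {X Y Z} → Hom (X ⊗₀ (Y ⊗₀ Z)) ((X ⊗₀ Y) ⊗₀ Z)
    lu   : ∀ {Y} → Hom (I ⊗₀ Y) Y
    lu⁻¹ : ∀ {Y} → Hom Y (I ⊗₀ Y)
    ru   : ∀ {X} → Hom (X ⊗₀ I) X
    ru⁻¹ : ∀ {X} → Hom X (X ⊗₀ I)
    σ    : ∀ {X Y} → Hom (X ⊗₀ Y) (Y ⊗₀ X)

    a-isoˡ  : ∀ {X Y Z} → a⁻¹ {X} {Y} {Z} ∘ a ≡ id
    a-isoʳ  : ∀ {X Y Z} → a {X} {Y} {Z} ∘ a⁻¹ ≡ id
    lu-isoˡ : ∀ {Y} → lu⁻¹ {Y} ∘ lu ≡ id
    lu-isoʳ : ∀ {Y} → lu {Y} ∘ lu⁻¹ ≡ id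
    ru-isoˡ : ∀ {X} → ru⁻¹ {X} ∘ ru ≡ id
    ru-isoʳ : ∀ {X} → ru {X} ∘ ru⁻¹ ≡ id
    σ-sym   : ∀ {X Y} → σ {Y} {X} ∘ σ {X} {Y} ≡ id

    a-natural  : ∀ {X X' Y Y' Z Z'} {f : Hom X X'} {g : Hom Y Y'} {k : Hom Z Z'} →
                 a ∘ ((f ⊗₁ g) ⊗₁ k) ≡ (f ⊗₁ (g ⊗₁ k)) ∘ a
    lu-natural : ∀ {Y Y'} {f : Hom Y Y'} → lu ∘ (id ⊗₁ f) ≡ f ∘ lu
    ru-natural : ∀ {X X'} {f : Hom X X'} → ru ∘ (f ⊗₁ id) ≡ f ∘ ru
    σ-natural  : ∀ {X X' Y Y'} {f : Hom X X'} {g : Hom Y Y'} →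
                 σ ∘ (f ⊗₁ g) ≡ (g ⊗₁ f) ∘ σ

    pentagon : ∀ {W X Y Z} →
               a {W} {X} {Y ⊗₀ Z} ∘ a {W ⊗₀ X} {Y} {Z}
               ≡ (id ⊗₁ a {X} {Y} {Z}) ∘ a {W} {X ⊗₀ Y} {Z} ∘ (a {W} {X} {Y} ⊗₁ id)
    triangle : ∀ {X Y} → (id {X} ⊗₁ lu {Y}) ∘ a ≡ ru ⊗₁ id
    hexagon  : ∀ {X Y Z} →
               a {Y} {Z} {X} ∘ σ {X} {Y ⊗₀ Z} ∘ a {X} {Y} {Z}
               ≡ (id ⊗₁ σ {X} {Z}) ∘ a {Y} {X} {Z} ∘ (σ {X} {Y} ⊗₁ id)

    _⊸₀_ : Obj → Obj → Obj
    _⊸₁_ : ∀ X {Y Z} → Hom Y Z → Hom (X ⊸₀ Y) (X ⊸₀ Z)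
    ⊸-id : ∀ {X Y} → X ⊸₁ id {Y} ≡ id
    ⊸-∘  : ∀ {X Y Z W} {f : Hom Y Z} {g : Hom Z W} → X ⊸₁ (g ∘ f) ≡ (X ⊸₁ g) ∘ (X ⊸₁ f)
    η  : ∀ {X Y} → Hom Y (X ⊸₀ (X ⊗₀ Y))
    ev : ∀ {X Y} → Hom (X ⊗₀ (X ⊸₀ Y)) Y
    η-natural  : ∀ {X Y Y'} {f : Hom Y Y'} → (X ⊸₁ (id ⊗₁ f)) ∘ η ≡ η ∘ f
    ev-natural : ∀ {X Y Y'} {f : Hom Y Y'} → f ∘ ev ≡ ev ∘ (id ⊗₁ (X ⊸₁ f))
    zig : ∀ {X Y} → ev {X} {X ⊗₀ Y} ∘ (id ⊗₁ η {X} {Y}) ≡ id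
    zag : ∀ {X Y} → (X ⊸₁ ev {X} {Y}) ∘ η {X} {X ⊸₀ Y} ≡ id

module _ {o h : Level} (C : SMCC o h) where
  open SMCC C

  record LaxQ (c ℓ₁ ℓ₂ : Level) : Set (o ⊔ h ⊔ lsuc (c ⊔ ℓ₁ ⊔ ℓ₂)) where
    field
      Q₀ : Obj → Poset c ℓ₁ ℓ₂
    ∣_∣ : Obj → Set c
    ∣ X ∣ = Poset.Carrier (Q₀ X)
    Leq : (X : Obj) → ∣ X ∣ → ∣ X ∣ → Set ℓ₂
    Leq X = Poset._≤_ (Q₀ X)
    syntax Leq X x y = x ≤[ X ] y
    Eq : (X : Obj) → ∣ X ∣ → ∣ X ∣ → Set ℓ₁
    Eq X = Poset._≈_ (Q₀ X)
    syntax Eq X x y = x ≈[ X ] y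
    field
      Q₁      : ∀ {X Y} → Hom X Y → ∣ X ∣ → ∣ Y ∣
      Q₁-mono : ∀ {X Y} (f : Hom X Y) {x x' : ∣ X ∣} → x ≤[ X ] x' → Q₁ f x ≤[ Y ] Q₁ f x'
      Q₁-id   : ∀ {X} (x : ∣ X ∣) → Q₁ id x ≈[ X ] x
      Q₁-∘    : ∀ {X Y Z} (f : Hom X Y) (g : Hom Y Z) (x : ∣ X ∣) →
                Q₁ (g ∘ f) x ≈[ Z ] Q₁ g (Q₁ f x)
      u  : ∣ I ∣
      μ  : ∀ {X Y} → ∣ X ∣ → ∣ Y ∣ → ∣ X ⊗₀ Y ∣
      μ-mono : ∀ {X Y} {x x' : ∣ X ∣} {y y' : ∣ Y ∣} →
               x ≤[ X ] x' → y ≤[ Y ] y' → μ x y ≤[ X ⊗₀ Y ] μ x' y'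
      μ-lax  : ∀ {X X' Y Y'} (f : Hom X X') (g : Hom Y Y') (x : ∣ X ∣) (y : ∣ Y ∣) →
               Q₁ (f ⊗₁ g) (μ x y) ≤[ X' ⊗₀ Y' ] μ (Q₁ f x) (Q₁ g y)
      μ-lu : ∀ {Y} (y : ∣ Y ∣) → Q₁ lu (μ u y) ≈[ Y ] y
      μ-ru : ∀ {X} (x : ∣ X ∣) → Q₁ ru (μ x u) ≈[ X ] x
      μ-a  : ∀ {X Y Z} (x : ∣ X ∣) (y : ∣ Y ∣) (z : ∣ Z ∣) →
             Q₁ a (μ (μ x y) z) ≈[ X ⊗₀ (Y ⊗₀ Z) ] μ x (μ y z)
      μ-σ  : ∀ {X Y} (x : ∣ X ∣) (y : ∣ Y ∣) →
             Q₁ σ (μ x y) ≈[ Y ⊗₀ X ] μ y x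

  module Setting {c ℓ₁ ℓ₂ : Level} (Q : LaxQ c ℓ₁ ℓ₂) where
    open LaxQ Q

    ⟨_,_⟩ : ∀ {X Y} → ∣ X ∣ → ∣ X ⊸₀ Y ∣ → ∣ Y ∣
    ⟨_,_⟩ {X} {Y} x b = Q₁ (ev {X} {Y}) (μ x b)

    MuViaPairing : Set (o ⊔ c ⊔ ℓ₁)
    MuViaPairing = ∀ {X Y} (x : ∣ X ∣) (y : ∣ Y ∣) →
                   μ x y ≈[ X ⊗₀ Y ] ⟨_,_⟩ {X} {X ⊗₀ Y} x (Q₁ (η {X} {Y}) y)

    Iota : Set (o ⊔ c)
    Iota = ∀ {X Y} → ∣ X ∣ → ∣ Y ∣ → ∣ X ⊸₀ Y ∣

    IsRightAdjoint : Iota → Set (o ⊔ c ⊔ ℓ₂)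
    IsRightAdjoint ι = ∀ {X Y} (α : ∣ X ∣) (b : ∣ X ⊸₀ Y ∣) (β : ∣ Y ∣) →
                       (⟨ α , b ⟩ ≤[ Y ] β) ⇔ (b ≤[ X ⊸₀ Y ] ι α β)

    module Dual (ι : Iota) (0C : Obj) (ω : ∣ 0C ∣) where
      _* : Obj → Obj
      X * = X ⊸₀ 0C

      ω[_] : ∀ X → ∣ X ∣ → ∣ X * ∣
      ω[ X ] α = ι {X} {0C} α ω

      -- canonical arrow j_X : X → X**, the transpose of ev_{X,0} ∘ σ_{X*,X}
      j : ∀ X → Hom X ((X *) *)
      j X = ((X *) ⊸₁ (ev {X} {0C} ∘ σ {X *} {X})) ∘ η {X *} {X}

      -- j_X : (X,α) → (X**, ω_{X*}(ω_X(α))) is an arrow of ∫Q and is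
      -- invertible in ∫Q
      record InvertibleInIntQ (X : Obj) (α : ∣ X ∣) : Set (h ⊔ ℓ₂) where
        field
          j-arrow : Q₁ (j X) α ≤[ (X *) * ] ω[ X * ] (ω[ X ] α)
          inv     : Hom ((X *) *) X
          inv-arrow : Q₁ inv (ω[ X * ] (ω[ X ] α)) ≤[ X ] α
          inv-left  : inv ∘ j X ≡ id
          inv-right : j X ∘ inv ≡ id

      Dualizing : Set (o ⊔ h ⊔ c ⊔ ℓ₂)
      Dualizing = ∀ X (α : ∣ X ∣) → InvertibleInIntQ X α

      IsPosetIsoFromOp : ∀ X → Set (c ⊔ ℓ₁ ⊔ ℓ₂)
      IsPosetIsoFromOp X =
        IsOrderIsomorphism (Poset._≈_ (Q₀ X)) (Poset._≈_ (Q₀ (X *)))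
                           (flip (Poset._≤_ (Q₀ X))) (Poset._≤_ (Q₀ (X *)))
                           ω[ X ]

{-# OPTIONS --safe #-}
module Submission where

-- Writing b ≤ ω_X(α) as ⟨α,b⟩ ≤ ω shows that ω_X is antitone,
-- and naturality of ev gives ⟨α,b⟩ ≤ ⟨b, Q(j_X)(α)⟩. If ω_X(α) ≤ ω_X(α'),
-- then transporting along the inverse of j_X in ∫Q yields
-- α' ≤ Q(j_X⁻¹)(ω_{X*}(ω_X(α'))) ≤ Q(j_X⁻¹)(ω_{X*}(ω_X(α))) ≤ α, so ω_X
-- reflects the order. For surjectivity, b ∈ Q(X*) is hit by
-- α := Q(j_X⁻¹)(ω_{X*}(b)): then Q(j_X)(α) = ω_{X*}(b), and the swap inequality
-- together with reflection gives b = ω_X(α). An element of Q(X) is needed only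
-- to obtain the inverse of j_X from the dualizing hypothesis.

open import Defs
open import Level using (Level)
open import Data.Product using (_,_)
open import Function.Bundles using (Equivalence)
open import Relation.Binary.Bundles using (Poset)
open import Relation.Binary.PropositionalEquality
  using (_≡_; cong; module ≡-Reasoning)
import Relation.Binary.Reasoning.PartialOrder as PartialOrderReasoning

module _ {o h : Level} (C : SMCC o h) where
  open SMCC C

  ev-transpose : ∀ {A X Y} (f : Hom (A ⊗₀ X) Y) → ev ∘ (id ⊗₁ ((A ⊸₁ f) ∘ η)) ≡ f
  ev-transpose {A} f = begin
    ev ∘ (id ⊗₁ ((A ⊸₁ f) ∘ η))               ≡⟨ cong (λ g → ev ∘ (g ⊗₁ _)) identityˡ ⟨
    ev ∘ ((id ∘ id) ⊗₁ ((A ⊸₁ f) ∘ η))        ≡⟨ cong (ev ∘_) ⊗-∘ ⟩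
    ev ∘ ((id ⊗₁ (A ⊸₁ f)) ∘ (id ⊗₁ η))       ≡⟨ assoc ⟨
    (ev ∘ (id ⊗₁ (A ⊸₁ f))) ∘ (id ⊗₁ η)       ≡⟨ cong (_∘ (id ⊗₁ η)) ev-natural ⟨
    (f ∘ ev) ∘ (id ⊗₁ η)                      ≡⟨ assoc ⟩
    f ∘ (ev ∘ (id ⊗₁ η))                      ≡⟨ cong (f ∘_) zig ⟩
    f ∘ id                                    ≡⟨ identityʳ ⟩
    f                                         ∎
    where open ≡-Reasoning

  module _ {c ℓ₁ ℓ₂ : Level} (Q : LaxQ C c ℓ₁ ℓ₂) where
    open LaxQ Q
    open Setting C Q
    module P (X : Obj) = Poset (Q₀ X)
    module ≤-Reasoning (X : Obj) = PartialOrderReasoning (Q₀ X)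

    Q₁-resp-≡ : ∀ {X Y} {f g : Hom X Y} (x : ∣ X ∣) → f ≡ g → Q₁ f x ≈[ Y ] Q₁ g x
    Q₁-resp-≡ {Y = Y} x f≡g = P.Eq.reflexive Y (cong (λ f → Q₁ f x) f≡g)

    Q₁-retraction : ∀ {X Y} {f : Hom X Y} {g : Hom Y X} → g ∘ f ≡ id →
                    ∀ x → Q₁ g (Q₁ f x) ≈[ X ] x
    Q₁-retraction {X} {f = f} {g} g∘f≡id x = begin-equality
      Q₁ g (Q₁ f x)  ≈⟨ Q₁-∘ f g x ⟨
      Q₁ (g ∘ f) x   ≈⟨ Q₁-resp-≡ x g∘f≡id ⟩
      Q₁ id x        ≈⟨ Q₁-id x ⟩
      x              ∎
      where open ≤-Reasoning X

    Q₁-cong : ∀ {X Y} (f : Hom X Y) {x x' : ∣ X ∣} → x ≈[ X ] x' → Q₁ f x ≈[ Y ] Q₁ f x'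
    Q₁-cong {X} {Y} f x≈x' = P.antisym Y (Q₁-mono f (P.reflexive X x≈x'))
                                         (Q₁-mono f (P.reflexive X (P.Eq.sym X x≈x')))

    pairing-mono : ∀ {X Y} {α α' : ∣ X ∣} {b b' : ∣ X ⊸₀ Y ∣} →
                   α ≤[ X ] α' → b ≤[ X ⊸₀ Y ] b' → ⟨ α , b ⟩ ≤[ Y ] ⟨ α' , b' ⟩
    pairing-mono α≤α' b≤b' = Q₁-mono ev (μ-mono α≤α' b≤b')

    module _ (ι : Iota) (adj : IsRightAdjoint ι) where
      ≤ι⇒pairing≤ : ∀ {X Y} {α : ∣ X ∣} {b : ∣ X ⊸₀ Y ∣} {β : ∣ Y ∣} →
                    b ≤[ X ⊸₀ Y ] ι α β → ⟨ α , b ⟩ ≤[ Y ] β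
      ≤ι⇒pairing≤ {α = α} {b} {β} = Equivalence.from (adj α b β)

      pairing≤⇒≤ι : ∀ {X Y} {α : ∣ X ∣} {b : ∣ X ⊸₀ Y ∣} {β : ∣ Y ∣} →
                    ⟨ α , b ⟩ ≤[ Y ] β → b ≤[ X ⊸₀ Y ] ι α β
      pairing≤⇒≤ι {α = α} {b} {β} = Equivalence.to (adj α b β)

      pairing-ι≤ : ∀ {X Y} (α : ∣ X ∣) (β : ∣ Y ∣) → ⟨ α , ι α β ⟩ ≤[ Y ] β
      pairing-ι≤ {X} {Y} α β = ≤ι⇒pairing≤ (P.refl (X ⊸₀ Y))

      ι-antitone : ∀ {X Y} {α α' : ∣ X ∣} (β : ∣ Y ∣) →
                   α' ≤[ X ] α → ι α β ≤[ X ⊸₀ Y ] ι α' β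
      ι-antitone {X} {Y} {α} {α'} β α'≤α = pairing≤⇒≤ι (begin
        ⟨ α' , ι α β ⟩  ≤⟨ pairing-mono α'≤α (P.refl (X ⊸₀ Y)) ⟩
        ⟨ α , ι α β ⟩   ≤⟨ pairing-ι≤ α β ⟩
        β               ∎)
        where open ≤-Reasoning Y

      module _ (0C : Obj) (ω : ∣ 0C ∣) where
        open Dual ι 0C ω

        ev∘id⊗j≡ev∘σ : ∀ X → ev ∘ (id ⊗₁ j X) ≡ ev ∘ σ
        ev∘id⊗j≡ev∘σ X = ev-transpose (ev ∘ σ)

        pairing≤pairing-j : ∀ {X} (α : ∣ X ∣) (b : ∣ X * ∣) →
                            ⟨ α , b ⟩ ≤[ 0C ] ⟨ b , Q₁ (j X) α ⟩
        pairing≤pairing-j {X} α b = begin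
          Q₁ ev (μ α b)                      ≈⟨ Q₁-cong ev (μ-σ b α) ⟨
          Q₁ ev (Q₁ σ (μ b α))               ≈⟨ Q₁-∘ σ ev (μ b α) ⟨
          Q₁ (ev ∘ σ) (μ b α)                ≈⟨ Q₁-resp-≡ (μ b α) (ev∘id⊗j≡ev∘σ X) ⟨
          Q₁ (ev ∘ (id ⊗₁ j X)) (μ b α)      ≈⟨ Q₁-∘ (id ⊗₁ j X) ev (μ b α) ⟩
          Q₁ ev (Q₁ (id ⊗₁ j X) (μ b α))     ≤⟨ Q₁-mono ev (μ-lax id (j X) b α) ⟩
          Q₁ ev (μ (Q₁ id b) (Q₁ (j X) α))   ≤⟨ pairing-mono (P.reflexive (X *) (Q₁-id b)) (P.refl ((X *) *)) ⟩
          Q₁ ev (μ b (Q₁ (j X) α))           ∎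
          where open ≤-Reasoning 0C

        j≤ωω⇒≤ω : ∀ {X} {α : ∣ X ∣} {b : ∣ X * ∣} →
                  Q₁ (j X) α ≤[ (X *) * ] ω[ X * ] b → b ≤[ X * ] ω[ X ] α
        j≤ωω⇒≤ω {X} {α} {b} jα≤ωb = pairing≤⇒≤ι (begin
          ⟨ α , b ⟩                ≤⟨ pairing≤pairing-j α b ⟩
          ⟨ b , Q₁ (j X) α ⟩       ≤⟨ pairing-mono (P.refl (X *)) jα≤ωb ⟩
          ⟨ b , ω[ X * ] b ⟩       ≤⟨ pairing-ι≤ b ω ⟩
          ω                        ∎)
          where open ≤-Reasoning 0C

        module _ (dual : Dualizing) where
          open InvertibleInIntQ

          ω-reflects : ∀ {X} {α α' : ∣ X ∣} →
                       ω[ X ] α ≤[ X * ] ω[ X ] α' → α' ≤[ X ] α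
          ω-reflects {X} {α} {α'} ωα≤ωα' = begin
            α'                                       ≈⟨ Q₁-retraction (inv-left (dual X α)) α' ⟨
            Q₁ j⁻¹ (Q₁ (j X) α')                     ≤⟨ Q₁-mono j⁻¹ (j-arrow (dual X α')) ⟩
            Q₁ j⁻¹ (ω[ X * ] (ω[ X ] α'))            ≤⟨ Q₁-mono j⁻¹ (ι-antitone ω ωα≤ωα') ⟩
            Q₁ j⁻¹ (ω[ X * ] (ω[ X ] α))             ≤⟨ inv-arrow (dual X α) ⟩
            α                                        ∎
            where
              j⁻¹ = inv (dual X α)
              open ≤-Reasoning X

          ω-surjective : ∀ {X} (α₀ : ∣ X ∣) (b : ∣ X * ∣) →
                         ω[ X ] (Q₁ (inv (dual X α₀)) (ω[ X * ] b)) ≈[ X * ] b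
          ω-surjective {X} α₀ b = P.antisym (X *) ωα≤b b≤ωα
            where
              j⁻¹ = inv (dual X α₀)
              α = Q₁ j⁻¹ (ω[ X * ] b)
              jα≈ωb : Q₁ (j X) α ≈[ (X *) * ] ω[ X * ] b
              jα≈ωb = Q₁-retraction (inv-right (dual X α₀)) (ω[ X * ] b)
              b≤ωα : b ≤[ X * ] ω[ X ] α
              b≤ωα = j≤ωω⇒≤ω (P.reflexive ((X *) *) jα≈ωb)
              ωα≤b : ω[ X ] α ≤[ X * ] b
              ωα≤b = ω-reflects (begin
                ω[ X * ] b                 ≈⟨ jα≈ωb ⟨
                Q₁ (j X) α                 ≤⟨ j-arrow (dual X α) ⟩
                ω[ X * ] (ω[ X ] α)        ∎)
                where open ≤-Reasoning ((X *) *)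

          ω-cong : ∀ {X} {α α' : ∣ X ∣} → α ≈[ X ] α' → ω[ X ] α ≈[ X * ] ω[ X ] α'
          ω-cong {X} α≈α' = P.antisym (X *) (ι-antitone ω (P.reflexive X (P.Eq.sym X α≈α')))
                                            (ι-antitone ω (P.reflexive X α≈α'))

          ω-isOrderIsomorphism : (∀ X → ∣ X ∣) → ∀ X → IsPosetIsoFromOp X
          ω-isOrderIsomorphism point X = record
            { isOrderMonomorphism = record
              { isOrderHomomorphism = record { cong = ω-cong ; mono = ι-antitone ω }
              ; injective = λ ωα≈ωα' → P.antisym X (ω-reflects (P.reflexive (X *) (P.Eq.sym (X *) ωα≈ωα')))
                                                    (ω-reflects (P.reflexive (X *) ωα≈ωα'))
              ; cancel = ω-reflects
              }
            ; surjective = λ b → _ , λ α≈ → P.Eq.trans (X *) (ω-cong α≈) (ω-surjective (point X) b)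
            }

-- The hypothesis MuViaPairing is only needed to make ∫Q closed, not for this argument.
mainTheorem8 : ∀ {o h c ℓ₁ ℓ₂ : Level} (C : SMCC o h) (Q : LaxQ C c ℓ₁ ℓ₂) →
               Setting.MuViaPairing C Q →
               (ι : Setting.Iota C Q) → Setting.IsRightAdjoint C Q ι →
               (∀ X → LaxQ.∣_∣ Q X) →
               (0C : SMCC.Obj C) (ω : LaxQ.∣_∣ Q 0C) →
               Setting.Dual.Dualizing C Q ι 0C ω →
               ∀ X → Setting.Dual.IsPosetIsoFromOp C Q ι 0C ω X
mainTheorem8 C Q _ ι adj point 0C ω dual = ω-isOrderIsomorphism C Q ι adj 0C ω dual point
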